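{- For every integer $n \geq 3$, $\nabla(C_{3} \times C_{n}) = n+1$.
   Context: For a simple graph $G$, a set $S \subseteq V(G)$ is a decycling set of $G$ if the graph $G - S$ obtained by deleting the vertices of $S$ is acyclic (a forest). The decycling number $\nabla(G)$ is the minimum cardinality of a decycling set of $G$. $C_k$ denotes the cycle on $k$ vertices, and $G \times H$ denotes the Cartesian product of graphs: vertex set $V(G)\times V(H)$, with $(g,h)$ adjacent to $(g',h')$ iff either $g=g'$ and $hh' \in E(H)$, or $h=h'$ and $gg' \in E(G)$. -}

module Defs where

open import Level using (0ℓ)
open import Data.Nat using (ℕ; suc; _≤_; _∸_)
open import Data.Fin using (Fin; toℕ)
open import Data.Product using (_×_; _,_; Σ)
open import Data.Sum using (_⊎_)
open import Data.List using (List; _∷_; _∷ʳ_; length)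
open import Data.List.Relation.Unary.Linked using (Linked)
open import Data.List.Relation.Unary.All using (All)
open import Data.List.Relation.Unary.Unique.Propositional using (Unique)
open import Data.List.Membership.Propositional using (_∈_; _∉_)
open import Relation.Binary.PropositionalEquality using (_≡_)

record Graph : Set₁ where
  field
    V   : Set
    Adj : V → V → Set
open Graph public

CStep : (k : ℕ) → Fin k → Fin k → Set
CStep k i j = (toℕ j ≡ suc (toℕ i)) ⊎ ((toℕ i ≡ k ∸ 1) × (toℕ j ≡ 0))

C : ℕ → Graph
C k = record { V = Fin k ; Adj = λ i j → CStep k i j ⊎ CStep k j i }

_□_ : Graph → Graph → Graph
G □ H = record
  { V   = V G × V H
  ; Adj = λ { (g , h) (g' , h') →
              ((g ≡ g') × Adj H h h') ⊎ ((h ≡ h') × Adj G g g') } }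

record CycleIn (G : Graph) : Set where
  field
    x      : V G
    xs     : List (V G)
    long   : 3 ≤ length (x ∷ xs)
    unique : Unique (x ∷ xs)
    closed : Linked (Adj G) ((x ∷ xs) ∷ʳ x)
open CycleIn public

IsAcyclicAfterDeleting : (G : Graph) → List (V G) → Set
IsAcyclicAfterDeleting G S =
  (c : CycleIn G) → All (λ v → v ∉ S) (x c ∷ xs c) → Data.Empty.⊥
  where import Data.Empty

IsDecyclingSet : (G : Graph) → List (V G) → Set
IsDecyclingSet G S = Unique S × IsAcyclicAfterDeleting G S

DecyclingNumberIs : Graph → ℕ → Set
DecyclingNumberIs G d =
  Σ (List (V G)) (λ S → IsDecyclingSet G S × length S ≡ d)
  × ((S : List (V G)) → IsDecyclingSet G S → d ≤ length S)

module Submission where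

-- Upper bound: deleting (2,0) and the cells (j mod 2, j) leaves a forest.  This is certified
-- by a depth function and a parent map such that every remaining edge joins a cell to its
-- parent one level up; a closed walk along such edges that never backtracks would have to
-- descend and then ascend, and so return to its start through its parent on both sides.
-- Lower bound: every column is a triangle, so a decycling set meets each column.  If it met
-- each column j in a single cell (c j , j), a cycle zigzagging through the columns on rows
-- avoiding c would survive; so some column holds two deleted cells, and there are n + 1.

open import Defs
open import Data.Nat using (ℕ; zero; suc; _≤_; _<_; _+_; z≤n; s≤s)
open import Data.Nat.Properties using (suc-injective; ≤-refl; ≤-reflexive; ≤-trans; <-trans; <-irrefl; <⇒≤; m≤n⇒m≤1+n; +-comm)
open import Data.Nat.DivMod using (_mod_; m≤n⇒m%n≡m)
open import Data.Fin using (Fin; zero; suc; toℕ; inject₁; fromℕ; pred)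
open import Data.Fin.Patterns using (0F; 1F; 2F)
open import Data.Fin.Properties using (injective⇒≤; toℕ-injective; toℕ-fromℕ; toℕ-fromℕ<; toℕ-inject₁; any?) renaming (_≟_ to _≟ᶠ_)
open import Data.Product using (Σ; ∃; _×_; _,_; proj₁; proj₂)
open import Data.Product.Properties using (≡-dec)
open import Data.Sum using (_⊎_; inj₁; inj₂; swap)
open import Data.Empty using (⊥; ⊥-elim)
open import Data.List using (List; []; _∷_; _∷ʳ_; length; map; allFin)
open import Data.List.Properties using (length-map; length-tabulate)
open import Data.List.Relation.Unary.Linked as Linked using (Linked; []; [-]; _∷_)
open import Data.List.Relation.Unary.Linked.Properties using (Linked⇒All)
open import Data.List.Relation.Unary.All as All using (All; []; _∷_; all?)
open import Data.List.Relation.Unary.All.Properties using (∷ʳ⁺; ∷ʳ⁻; ¬All⇒Any¬)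
open import Data.List.Relation.Unary.Any using (here; there)
open import Data.List.Relation.Unary.AllPairs using ([]; _∷_)
open import Data.List.Relation.Unary.Unique.Propositional using (Unique)
open import Data.List.Relation.Unary.Unique.Propositional.Properties using (Unique[x∷xs]⇒x∉xs; allFin⁺) renaming (map⁺ to Unique-map⁺)
open import Data.List.Membership.Propositional using (_∈_; _∉_; find)
open import Data.List.Membership.Propositional.Properties using (∈-map⁺; ∈-allFin)
open import Data.List.Membership.Setoid.Properties using (index-injective)
open import Function.Definitions using (Injective)
open import Relation.Binary.PropositionalEquality using (_≡_; _≢_; refl; sym; trans; cong; subst; setoid; module ≡-Reasoning)
open import Relation.Nullary using (Dec; yes; no)

data NonBacktracking {A : Set} : List A → Set where
  []    : NonBacktracking []
  [-]   : ∀ {x} → NonBacktracking (x ∷ [])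
  [-,-] : ∀ {x y} → NonBacktracking (x ∷ y ∷ [])
  _∷_   : ∀ {x y z l} → x ≢ z → NonBacktracking (y ∷ z ∷ l) → NonBacktracking (x ∷ y ∷ z ∷ l)

unique-snoc⇒nonBacktracking : ∀ {A : Set} {z : A} xs → Unique xs → z ∉ xs → NonBacktracking (xs ∷ʳ z)
unique-snoc⇒nonBacktracking []          _                      _   = [-]
unique-snoc⇒nonBacktracking (_ ∷ [])    _                      _   = [-,-]
unique-snoc⇒nonBacktracking (_ ∷ _ ∷ []) _                     z∉ = (λ x≡z → z∉ (here (sym x≡z))) ∷ [-,-]
unique-snoc⇒nonBacktracking (_ ∷ y ∷ z ∷ l) ((_ ∷ x≢z ∷ _) ∷ u) z∉ = x≢z ∷ unique-snoc⇒nonBacktracking (y ∷ z ∷ l) u (λ z∈ → z∉ (there z∈))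

closed-walk-nonBacktracking : ∀ {A : Set} {x v y : A} {l} → Unique (x ∷ v ∷ y ∷ l) → NonBacktracking (x ∷ v ∷ y ∷ l ∷ʳ x)
closed-walk-nonBacktracking {v = v} {y} {l} u@((_ ∷ x≢y ∷ _) ∷ u′) =
  x≢y ∷ unique-snoc⇒nonBacktracking (v ∷ y ∷ l) u′ (Unique[x∷xs]⇒x∉xs u)

mapWithin : ∀ {A : Set} {P : A → Set} {R Q : A → A → Set} {xs} →
            (∀ {u v} → P u → P v → R u v → Q u v) → All P xs → Linked R xs → Linked Q xs
mapWithin f _               []         = []
mapWithin f _               [-]        = [-]
mapWithin f (pu ∷ pv ∷ ps) (r ∷ rs) = f pu pv r ∷ mapWithin f (pv ∷ ps) rs

module TreeCertificate {Vertex : Set} (depth : Vertex → ℕ) (parent : Vertex → Vertex) where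

  _⋖_ : Vertex → Vertex → Set
  u ⋖ v = depth v ≡ suc (depth u) × parent v ≡ u

  TreeStep : Vertex → Vertex → Set
  TreeStep u v = u ⋖ v ⊎ v ⋖ u

  ⋖⇒depth< : ∀ {u v} → u ⋖ v → depth u < depth v
  ⋖⇒depth< (d , _) = ≤-reflexive (sym d)

  ⋖-parent-unique : ∀ {u v w} → u ⋖ v → w ⋖ v → u ≡ w
  ⋖-parent-unique (_ , p) (_ , q) = trans (sym p) q

  ascent-persists : ∀ {u v w} → NonBacktracking (u ∷ v ∷ w) → Linked TreeStep (v ∷ w) → u ⋖ v →
                    Linked _⋖_ (u ∷ v ∷ w)
  ascent-persists _          [-]                  u⋖v = u⋖v ∷ [-]
  ascent-persists (_   ∷ nb) (inj₁ v⋖y ∷ steps) u⋖v = u⋖v ∷ ascent-persists nb steps v⋖y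
  ascent-persists (u≢y ∷ _)  (inj₂ y⋖v ∷ _)     u⋖v = ⊥-elim (u≢y (⋖-parent-unique u⋖v y⋖v))

  ascending⇒depth< : ∀ {u w} → Linked _⋖_ (u ∷ w) → All (λ v → depth u < depth v) w
  ascending⇒depth< [-]           = []
  ascending⇒depth< (u⋖v ∷ steps) = Linked⇒All (λ p q → <-trans p q) (⋖⇒depth< u⋖v) (Linked.map ⋖⇒depth< steps)

  last-parent : ∀ {y} l {z} → Linked _⋖_ (y ∷ l ∷ʳ z) → parent z ∈ y ∷ l
  last-parent []      (y⋖z ∷ [-]) = here (proj₂ y⋖z)
  last-parent (_ ∷ l) (_ ∷ steps) = there (last-parent l steps)

  -- A non-backtracking tree walk descends and then ascends, so if it ends higher than it
  -- starts, its last step is an ascent.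
  valley-end : ∀ {u y} l {z} → NonBacktracking (u ∷ y ∷ l ∷ʳ z) → Linked TreeStep (u ∷ y ∷ l ∷ʳ z) →
               depth u < depth z → parent z ∈ y ∷ l
  valley-end l       nb       (inj₁ u⋖y ∷ steps)          _   = last-parent l (Linked.tail (ascent-persists nb steps u⋖y))
  valley-end []      _        (inj₂ _ ∷ inj₁ y⋖z ∷ [-])   _   = here (proj₂ y⋖z)
  valley-end []      _        (inj₂ y⋖u ∷ inj₂ z⋖y ∷ [-]) u<z =
    ⊥-elim (<-irrefl refl (<-trans (⋖⇒depth< z⋖y) (<-trans (⋖⇒depth< y⋖u) u<z)))
  valley-end (_ ∷ l) (_ ∷ nb) (inj₂ y⋖u ∷ steps)          u<z = there (valley-end l nb steps (<-trans (⋖⇒depth< y⋖u) u<z))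

  tree-walk-not-closed : ∀ {x xs} → Unique (x ∷ xs) → 3 ≤ length (x ∷ xs) → Linked TreeStep ((x ∷ xs) ∷ʳ x) → ⊥
  tree-walk-not-closed {xs = []}    _ (s≤s ())
  tree-walk-not-closed {xs = _ ∷ []} _ (s≤s (s≤s ()))
  tree-walk-not-closed {xs = v ∷ y ∷ l} uniq _ (inj₁ x⋖v ∷ steps) =
    <-irrefl refl (proj₂ (∷ʳ⁻ {xs = v ∷ y ∷ l} (ascending⇒depth< (ascent-persists (closed-walk-nonBacktracking uniq) steps x⋖v))))
  tree-walk-not-closed {xs = _ ∷ _ ∷ l} uniq@(_ ∷ uniq′) _ (inj₂ v⋖x ∷ steps) with closed-walk-nonBacktracking uniq
  ... | _ ∷ nb = Unique[x∷xs]⇒x∉xs uniq′ (subst (_∈ _) (proj₂ v⋖x) (valley-end l nb steps (⋖⇒depth< v⋖x)))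

tree-certificate⇒acyclic : (G : Graph) (S : List (V G)) (depth : V G → ℕ) (parent : V G → V G) →
                           (∀ {u v} → u ∉ S → v ∉ S → Adj G u v → TreeCertificate.TreeStep depth parent u v) →
                           IsAcyclicAfterDeleting G S
tree-certificate⇒acyclic G S depth parent edge c avoids@(x∉S ∷ _) =
  tree-walk-not-closed (unique c) (long c) (mapWithin edge (∷ʳ⁺ avoids x∉S) (closed c))
  where open TreeCertificate depth parent

injective⇒≤length : ∀ {A : Set} {k} {xs : List A} (f : Fin k → A) → Injective _≡_ _≡_ f →
                    (∀ i → f i ∈ xs) → k ≤ length xs
injective⇒≤length f f-injective f∈xs =
  injective⇒≤ (λ eq → f-injective (index-injective (setoid _) (f∈xs _) (f∈xs _) eq))

freshRow : (a b : Fin 3) → Σ (Fin 3) (λ r → r ≢ a × r ≢ b)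
freshRow 0F 0F = 1F , (λ ()) , (λ ())
freshRow 0F 1F = 2F , (λ ()) , (λ ())
freshRow 0F 2F = 1F , (λ ()) , (λ ())
freshRow 1F 0F = 2F , (λ ()) , (λ ())
freshRow 1F 1F = 0F , (λ ()) , (λ ())
freshRow 1F 2F = 0F , (λ ()) , (λ ())
freshRow 2F 0F = 1F , (λ ()) , (λ ())
freshRow 2F 1F = 0F , (λ ()) , (λ ())
freshRow 2F 2F = 0F , (λ ()) , (λ ())

distinct⇒adjacent-C₃ : ∀ r r′ → r ≢ r′ → Adj (C 3) r r′
distinct⇒adjacent-C₃ 0F 0F ne = ⊥-elim (ne refl)
distinct⇒adjacent-C₃ 0F 1F _  = inj₁ (inj₁ refl)
distinct⇒adjacent-C₃ 0F 2F _  = inj₂ (inj₂ (refl , refl))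
distinct⇒adjacent-C₃ 1F 0F _  = inj₂ (inj₁ refl)
distinct⇒adjacent-C₃ 1F 1F ne = ⊥-elim (ne refl)
distinct⇒adjacent-C₃ 1F 2F _  = inj₁ (inj₁ refl)
distinct⇒adjacent-C₃ 2F 0F _  = inj₁ (inj₂ (refl , refl))
distinct⇒adjacent-C₃ 2F 1F _  = inj₂ (inj₁ refl)
distinct⇒adjacent-C₃ 2F 2F ne = ⊥-elim (ne refl)

data CycleStep {k : ℕ} : Fin (suc k) → Fin (suc k) → Set where
  next : ∀ i → CycleStep (inject₁ i) (suc i)
  wrap : CycleStep (fromℕ k) zero

cycleStep : ∀ {k} {i j : Fin (suc k)} → CStep (suc k) i j → CycleStep i j
cycleStep {j = zero}  (inj₁ ())
cycleStep {k} {j = zero} (inj₂ (i≡k , _)) =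
  subst (λ i → CycleStep i zero) (toℕ-injective (trans (toℕ-fromℕ k) (sym i≡k))) wrap
cycleStep {j = suc j} (inj₁ j≡i) =
  subst (λ i → CycleStep i (suc j)) (toℕ-injective (trans (toℕ-inject₁ j) (suc-injective j≡i))) (next j)
cycleStep {j = suc j} (inj₂ (_ , ()))

module Torus (m : ℕ) where

  Column : Set
  Column = Fin (suc m)

  Cell : Set
  Cell = Fin 3 × Column

  G : Graph
  G = C 3 □ C (suc m)

  horizontal : ∀ {r j j′} → CStep (suc m) j′ j → Adj G (r , j) (r , j′)
  horizontal step = inj₁ (refl , inj₂ step)

  vertical : ∀ {r r′ j} → r ≢ r′ → Adj G (r , j) (r′ , j)
  vertical {r} {r′} ne = inj₂ (refl , distinct⇒adjacent-C₃ r r′ ne)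

  col : ℕ → Column
  col t = t mod suc m

  toℕ-col : ∀ {t} → t ≤ m → toℕ (col t) ≡ t
  toℕ-col t≤m = trans (toℕ-fromℕ< _) (m≤n⇒m%n≡m t≤m)

  col-step : ∀ {t} → suc t ≤ m → CStep (suc m) (col t) (col (suc t))
  col-step t<m = inj₁ (trans (toℕ-col t<m) (cong suc (sym (toℕ-col (<⇒≤ t<m)))))

  col-wrap : CStep (suc m) (col m) (col 0)
  col-wrap = inj₂ (toℕ-col ≤-refl , toℕ-col z≤n)

  section+ : (Column → Fin 3) → Cell → Fin (suc (suc m)) → Cell
  section+ s v zero    = v
  section+ s v (suc j) = s j , j

  OffSection : (Column → Fin 3) → Cell → Set
  OffSection s v = proj₁ v ≢ s (proj₂ v)

  section+-injective : ∀ s v → OffSection s v → Injective _≡_ _≡_ (section+ s v)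
  section+-injective s v off {zero}  {zero}  _    = refl
  section+-injective s v off {zero}  {suc j} refl = ⊥-elim (off refl)
  section+-injective s v off {suc i} {zero}  refl = ⊥-elim (off refl)
  section+-injective s v off {suc i} {suc j} eq   = cong suc (cong proj₂ eq)

  open import Data.List.Membership.DecPropositional (≡-dec (_≟ᶠ_ {3}) (_≟ᶠ_ {suc m})) using (_∈?_)

  turn : Fin 3 → Fin 3 → Column → List Cell → List Cell
  turn r r′ j rest with r ≟ᶠ r′
  ... | yes _ = rest
  ... | no _  = (r′ , j) ∷ rest

  length-turn : ∀ r r′ j rest → length rest ≤ length (turn r r′ j rest)
  length-turn r r′ j rest with r ≟ᶠ r′
  ... | yes _ = ≤-refl
  ... | no _  = m≤n⇒m≤1+n ≤-refl

  module _ {r r′ : Fin 3} {j : Column} {rest : List Cell} where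

    turn-All : ∀ {P : Cell → Set} → P (r , j) → P (r′ , j) → All P rest → All P (turn r r′ j rest)
    turn-All _ p′ ps with r ≟ᶠ r′
    ... | yes _ = ps
    ... | no _  = p′ ∷ ps

    turn-linked : ∀ {z} → Linked (Adj G) ((r′ , j) ∷ rest ∷ʳ z) → Linked (Adj G) ((r , j) ∷ turn r r′ j rest ∷ʳ z)
    turn-linked steps with r ≟ᶠ r′
    ... | yes refl = steps
    ... | no r≢r′  = vertical r≢r′ ∷ steps

    turn-unique : All ((r , j) ≢_) rest → Unique ((r′ , j) ∷ rest) → Unique ((r , j) ∷ turn r r′ j rest)
    turn-unique fresh uniq with r ≟ᶠ r′
    ... | yes refl = uniq
    ... | no r≢r′  = ((λ eq → r≢r′ (cong proj₁ eq)) ∷ fresh) ∷ uniq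

  -- It runs through the columns m, m-1, …, 0 and back to m,
  -- leaving column t towards the previous column (cyclically) on row crossing t, which avoids c
  -- in both columns; inside a column it turns vertically when its entry and exit rows differ.
  -- after t r lists the cells that follow (r , col t).
  module Zigzag (c : Column → Fin 3) where

    crossing : ℕ → Fin 3
    crossing zero    = proj₁ (freshRow (c (col m)) (c (col 0)))
    crossing (suc t) = proj₁ (freshRow (c (col t)) (c (col (suc t))))

    crossing≢here : ∀ t → crossing t ≢ c (col t)
    crossing≢here zero    = proj₂ (proj₂ (freshRow (c (col m)) (c (col 0))))
    crossing≢here (suc t) = proj₂ (proj₂ (freshRow (c (col t)) (c (col (suc t)))))

    crossing≢below : ∀ t → crossing (suc t) ≢ c (col t)
    crossing≢below t = proj₁ (proj₂ (freshRow (c (col t)) (c (col (suc t)))))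

    crossing≢top : crossing 0 ≢ c (col m)
    crossing≢top = proj₁ (proj₂ (freshRow (c (col m)) (c (col 0))))

    after : ℕ → Fin 3 → List Cell
    after zero    r = turn r (crossing 0) (col 0) []
    after (suc t) r = turn r (crossing (suc t)) (col (suc t)) ((crossing (suc t) , col t) ∷ after t (crossing (suc t)))

    after-avoids : ∀ t {r} → r ≢ c (col t) → All (OffSection c) ((r , col t) ∷ after t r)
    after-avoids zero    r≢ = r≢ ∷ turn-All r≢ (crossing≢here 0) []
    after-avoids (suc t) r≢ = r≢ ∷ turn-All r≢ (crossing≢here (suc t)) (after-avoids t (crossing≢below t))

    after-columns : ∀ t {r} → t ≤ m → All (λ v → toℕ (proj₂ v) ≤ t) ((r , col t) ∷ after t r)
    after-columns zero    t≤m = here≤ ∷ turn-All here≤ here≤ []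
      where here≤ = ≤-reflexive (toℕ-col t≤m)
    after-columns (suc t) t≤m =
      here≤ ∷ turn-All here≤ here≤ (All.map m≤n⇒m≤1+n (after-columns t (<⇒≤ t≤m)))
      where here≤ = ≤-reflexive (toℕ-col t≤m)

    after-unique : ∀ t {r} → t ≤ m → Unique ((r , col t) ∷ after t r)
    after-unique zero    _   = turn-unique [] ([] ∷ [])
    after-unique (suc t) t≤m = turn-unique (newColumn _) (newColumn _ ∷ after-unique t (<⇒≤ t≤m))
      where
      newColumn : ∀ r → All ((r , col (suc t)) ≢_) ((crossing (suc t) , col t) ∷ after t (crossing (suc t)))
      newColumn r = All.map (λ { col≤t refl → <-irrefl refl (subst (_≤ t) (toℕ-col t≤m) col≤t) }) (after-columns t (<⇒≤ t≤m))

    after-linked : ∀ t {r z} → t ≤ m → Adj G (crossing 0 , col 0) z → Linked (Adj G) ((r , col t) ∷ after t r ∷ʳ z)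
    after-linked zero    _   closing = turn-linked (closing ∷ [-])
    after-linked (suc t) t≤m closing = turn-linked (horizontal (col-step t≤m) ∷ after-linked t (<⇒≤ t≤m) closing)

    length-after : ∀ t {r} → t ≤ length (after t r)
    length-after zero    = z≤n
    length-after (suc t) {r} = ≤-trans (s≤s (length-after t)) (length-turn r (crossing (suc t)) (col (suc t)) _)

    cycle : 2 ≤ m → Σ (CycleIn G) (λ cyc → All (OffSection c) (x cyc ∷ xs cyc))
    cycle 2≤m = record { x      = crossing 0 , col m
                       ; xs     = after m (crossing 0)
                       ; long   = s≤s (≤-trans 2≤m (length-after m))
                       ; unique = after-unique m ≤-refl
                       ; closed = after-linked m ≤-refl (horizontal col-wrap) }
              , after-avoids m crossing≢top

  module _ {S : List Cell} (acyclic : IsAcyclicAfterDeleting G S) where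

    column-meets : ∀ j → ∃ λ r → (r , j) ∈ S
    column-meets j with any? (λ r → (r , j) ∈? S)
    ... | yes found = found
    ... | no none   = ⊥-elim (acyclic triangle (avoid 0F ∷ avoid 1F ∷ avoid 2F ∷ []))
      where
      avoid : ∀ r → (r , j) ∉ S
      avoid r r∈S = none (r , r∈S)
      triangle : CycleIn G
      triangle = record { x      = 0F , j
                        ; xs     = (1F , j) ∷ (2F , j) ∷ []
                        ; long   = s≤s (s≤s (s≤s z≤n))
                        ; unique = ((λ ()) ∷ (λ ()) ∷ []) ∷ ((λ ()) ∷ []) ∷ [] ∷ []
                        ; closed = vertical (λ ()) ∷ vertical (λ ()) ∷ vertical (λ ()) ∷ [-] }

    section : Column → Fin 3
    section j = proj₁ (column-meets j)

    on-section? : ∀ v → Dec (proj₁ v ≡ section (proj₂ v))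
    on-section? v = proj₁ v ≟ᶠ section (proj₂ v)

    some-off-section : 2 ≤ m → ∃ λ v → v ∈ S × OffSection section v
    some-off-section 2≤m with all? on-section? S
    ... | yes onSection = ⊥-elim (acyclic (proj₁ zigzag) (All.map (λ off v∈S → off (All.lookup onSection v∈S)) (proj₂ zigzag)))
      where zigzag = Zigzag.cycle section 2≤m
    ... | no notOnSection = find (¬All⇒Any¬ on-section? S notOnSection)

    decycling-lower-bound : 2 ≤ m → suc m + 1 ≤ length S
    decycling-lower-bound 2≤m with some-off-section 2≤m
    ... | v , v∈S , off =
      subst (_≤ length S) (+-comm 1 (suc m)) (injective⇒≤length (section+ section v) (section+-injective section v off) members)
      where
      members : ∀ i → section+ section v i ∈ S
      members zero    = v∈S
      members (suc j) = proj₂ (column-meets j)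

alternating : ℕ → Fin 3
alternating zero          = 0F
alternating (suc zero)    = 1F
alternating (suc (suc t)) = alternating t

alternating-binary : ∀ t → alternating t ≡ 0F ⊎ alternating t ≡ 1F
alternating-binary zero          = inj₁ refl
alternating-binary (suc zero)    = inj₂ refl
alternating-binary (suc (suc t)) = alternating-binary t

alternating-consecutive : ∀ t {r} → r ≢ 2F → r ≡ alternating t ⊎ r ≡ alternating (suc t)
alternating-consecutive zero          {0F} _   = inj₁ refl
alternating-consecutive zero          {1F} _   = inj₂ refl
alternating-consecutive (suc zero)    {0F} _   = inj₂ refl
alternating-consecutive (suc zero)    {1F} _   = inj₁ refl
alternating-consecutive _             {2F} r≢2 = ⊥-elim (r≢2 refl)
alternating-consecutive (suc (suc t))      r≢2 = alternating-consecutive t r≢2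

-- What remains is the path of row 2 through columns 1, …, n-1, each of its cells carrying the
-- surviving cell of rows 0, 1 in its column, and the cell (1,0), joined at most to (1,n-1).
module StripedDecyclingSet (m : ℕ) where

  open Torus (suc m)

  stripes : Column → Fin 3
  stripes j = alternating (toℕ j)

  decycling-set : List Cell
  decycling-set = map (section+ stripes (2F , zero)) (allFin (suc (suc (suc m))))

  stripe∈decycling-set : ∀ {r} j → r ≡ stripes j → (r , j) ∈ decycling-set
  stripe∈decycling-set j refl = ∈-map⁺ (section+ stripes (2F , zero)) (∈-allFin (suc j))

  corner∈decycling-set : (2F , zero) ∈ decycling-set
  corner∈decycling-set = ∈-map⁺ (section+ stripes (2F , zero)) (∈-allFin zero)

  depth : Cell → ℕ
  depth (2F , j)    = toℕ j
  depth (_ , zero)  = suc (suc (suc m))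
  depth (_ , suc i) = suc (suc (toℕ i))

  parent : Cell → Cell
  parent (2F , j)    = 2F , pred j
  parent (r , zero)  = r , fromℕ (suc m)
  parent (_ , suc i) = 2F , suc i

  open TreeCertificate depth parent

  stripes-block-row : ∀ {r} i → r ≢ 2F → (r , inject₁ i) ∉ decycling-set → (r , suc i) ∉ decycling-set → ⊥
  stripes-block-row {r} i r≢2 u∉ v∉ with alternating-consecutive (toℕ i) r≢2
  ... | inj₁ r≡ = u∉ (stripe∈decycling-set (inject₁ i) (trans r≡ (cong alternating (sym (toℕ-inject₁ i)))))
  ... | inj₂ r≡ = v∉ (stripe∈decycling-set (suc i) r≡)

  horizontal-step : ∀ r {j j′} → (r , j) ∉ decycling-set → (r , j′) ∉ decycling-set → CycleStep j j′ → (r , j) ⋖ (r , j′)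
  horizontal-step 0F u∉ v∉ (next i) = ⊥-elim (stripes-block-row i (λ ()) u∉ v∉)
  horizontal-step 1F u∉ v∉ (next i) = ⊥-elim (stripes-block-row i (λ ()) u∉ v∉)
  horizontal-step 2F _  _  (next i) = cong suc (sym (toℕ-inject₁ i)) , refl
  horizontal-step 0F _  v∉ wrap     = ⊥-elim (v∉ (stripe∈decycling-set zero refl))
  horizontal-step 1F _  _  wrap     = cong (λ t → suc (suc (suc t))) (sym (toℕ-fromℕ m)) , refl
  horizontal-step 2F _  v∉ wrap     = ⊥-elim (v∉ corner∈decycling-set)

  vertical-step : ∀ {r r′} j → (r , j) ∉ decycling-set → (r′ , j) ∉ decycling-set → CycleStep r r′ → TreeStep (r , j) (r′ , j)
  vertical-step j u∉ v∉ (next 0F) with alternating-binary (toℕ j)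
  ... | inj₁ stripe≡0 = ⊥-elim (u∉ (stripe∈decycling-set j (sym stripe≡0)))
  ... | inj₂ stripe≡1 = ⊥-elim (v∉ (stripe∈decycling-set j (sym stripe≡1)))
  vertical-step zero    _  v∉ (next 1F) = ⊥-elim (v∉ corner∈decycling-set)
  vertical-step (suc i) _  _  (next 1F) = inj₂ (refl , refl)
  vertical-step zero    u∉ _  wrap      = ⊥-elim (u∉ corner∈decycling-set)
  vertical-step (suc i) _  _  wrap      = inj₁ (refl , refl)

  tree-step : ∀ {u v} → u ∉ decycling-set → v ∉ decycling-set → Adj G u v → TreeStep u v
  tree-step {_ , _} {_ , _} u∉ v∉ (inj₁ (refl , inj₁ step)) = inj₁ (horizontal-step _ u∉ v∉ (cycleStep step))
  tree-step {_ , _} {_ , _} u∉ v∉ (inj₁ (refl , inj₂ step)) = inj₂ (horizontal-step _ v∉ u∉ (cycleStep step))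
  tree-step {_ , _} {_ , _} u∉ v∉ (inj₂ (refl , inj₁ step)) = vertical-step _ u∉ v∉ (cycleStep step)
  tree-step {_ , _} {_ , _} u∉ v∉ (inj₂ (refl , inj₂ step)) = swap (vertical-step _ v∉ u∉ (cycleStep step))

  decycling-set-isDecycling : IsDecyclingSet G decycling-set
  decycling-set-isDecycling =
    Unique-map⁺ (section+-injective stripes (2F , zero) (λ ())) (allFin⁺ _) ,
    tree-certificate⇒acyclic G decycling-set depth parent tree-step

  length-decycling-set : length decycling-set ≡ suc (suc m) + 1
  length-decycling-set = begin
    length decycling-set                ≡⟨ length-map (section+ stripes (2F , zero)) (allFin (suc (suc (suc m)))) ⟩
    length (allFin (suc (suc (suc m)))) ≡⟨ length-tabulate {n = suc (suc (suc m))} (λ j → j) ⟩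
    suc (suc (suc m))                   ≡⟨ +-comm 1 (suc (suc m)) ⟩
    suc (suc m) + 1                     ∎
    where open ≡-Reasoning

theorem2 : (n : ℕ) → 3 ≤ n → DecyclingNumberIs (C 3 □ C n) (n + 1)
theorem2 (suc (suc (suc k))) (s≤s (s≤s (s≤s z≤n))) =
  (decycling-set , decycling-set-isDecycling , length-decycling-set) ,
  λ _ (_ , acyclic) → Torus.decycling-lower-bound (suc (suc k)) acyclic (s≤s (s≤s z≤n))
  where open StripedDecyclingSet (suc k)
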